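{- Let $\pi\in\mathcal{S}_n$ be collapsed and let $w=w_1w_2\cdots\in\mathbb{N}^\infty$ with $\mathrm{Pat}(w,\Sigma,n)=\pi$. Then $w_m\ge z_m+1$, with equality if and only if $w_{[1,n)}=z^{(i)}_{[1,n)}$ for some $0\le i<|r-\ell|$.
   Context: $\mathbb{N}=\{0,1,2,\dots\}$. Alternating lexicographical order on sequences: $v<w$ if for some $k$, $v_1\cdots v_{k-1}=w_1\cdots w_{k-1}$ and $v_k<w_k$ for odd $k$, $w_k<v_k$ for even $k$. $w_{[i,j)}=w_i\cdots w_{j-1}$, $w_{[i,\infty)}=w_iw_{i+1}\cdots$. $\mathrm{Pat}(w,\Sigma,n)=\pi$ means $w_{[\pi^{ -1}(1),\infty)}<\cdots<w_{[\pi^{ -1}(n),\infty)}$. For $\pi\in\mathcal{S}_n$: $m=\pi^{ -1}(n)$; $\ell=\pi^{ -1}(\pi(n)-1)$ if $\pi(n)\ne1$; $r=\pi^{ -1}(\pi(n)+1)$ if $\pi(n)\ne n$; for $1\le j<n$, $z_j=\#\{1\le i<\pi(j):\ (i\ne\pi(n)\ne i+1$ and $\pi(\pi^{ -1}(i)+1)<\pi(\pi^{ -1}(i+1)+1))$ or $(i+1=\pi(n)\ne n$ and $\pi(\ell+1)<\pi(r+1))\}$. $\pi$ is collapsed if $\pi(n)\notin\{1,n\}$ and (as words) $z_{[\ell,n)}=z_{[r,n)}z_{[r,n)}$ or $z_{[r,n)}=z_{[\ell,n)}z_{[\ell,n)}$. For collapsed $\pi$, $0\le i<|r-\ell|$,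 $1\le j<n$: $z^{(i)}_j=z_j+1$ if ($\pi(j)\ge\pi(r+i)$ and $i$ even) or ($\pi(j)\ge\pi(\ell+i)$ and $i$ odd), otherwise $z^{(i)}_j=z_j$. -}

module Defs where

open import Data.Nat using (ℕ; zero; suc; _+_; _∸_; _≤_; _<_; _<?_; _%_)
open import Data.Nat.Base using (_≡ᵇ_; _<ᵇ_; _≤ᵇ_; ∣_-_∣)
open import Data.Bool using (Bool; true; false; not; _∧_; _∨_; if_then_else_)
open import Data.Fin using (Fin; toℕ; fromℕ<)
open import Data.Fin.Permutation using (Permutation′; _⟨$⟩ʳ_; _⟨$⟩ˡ_)
open import Data.List using (List; map; upTo; filter; length; _++_)
open import Data.Product using (∃-syntax; _×_)
open import Relation.Binary.PropositionalEquality using (_≡_; _≢_)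
open import Relation.Nullary.Decidable using (yes; no)
import Data.Sum
import Data.Bool

-- Conventions: positions and values are 1-based natural numbers.
-- π(j) for 1 ≤ j ≤ n; value 0 outside this range (never used there).
perm : ∀ {n} → Permutation′ n → ℕ → ℕ
perm π zero = 0
perm {n} π (suc j) with j <? n
... | yes j<n = suc (toℕ (π ⟨$⟩ʳ fromℕ< j<n))
... | no _ = 0

permInv : ∀ {n} → Permutation′ n → ℕ → ℕ
permInv π zero = 0
permInv {n} π (suc j) with j <? n
... | yes j<n = suc (toℕ (π ⟨$⟩ˡ fromℕ< j<n))
... | no _ = 0

range : ℕ → ℕ → List ℕ
range a b = map (a +_) (upTo (b ∸ a))

module _ {n : ℕ} (π : Permutation′ n) where
  mIdx : ℕ
  mIdx = permInv π n

  ℓIdx : ℕ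
  ℓIdx = permInv π (perm π n ∸ 1)

  rIdx : ℕ
  rIdx = permInv π (perm π n + 1)

  zCond : ℕ → Bool
  zCond i =
    (not (i ≡ᵇ perm π n) ∧ not (perm π n ≡ᵇ (i + 1))
       ∧ (perm π (permInv π i + 1) <ᵇ perm π (permInv π (i + 1) + 1)))
    ∨ (((i + 1) ≡ᵇ perm π n) ∧ not (perm π n ≡ᵇ n)
       ∧ (perm π (ℓIdx + 1) <ᵇ perm π (rIdx + 1)))

  z : ℕ → ℕ
  z j = length (filter (λ i → zCond i Data.Bool.≟ true) (range 1 (perm π j)))

  zWord : ℕ → List ℕ
  zWord a = map z (range a n)

  Collapsed : Set
  Collapsed = (perm π n ≢ 1) × (perm π n ≢ n)
    × ((zWord ℓIdx ≡ zWord rIdx ++ zWord rIdx)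
       Data.Sum.⊎ (zWord rIdx ≡ zWord ℓIdx ++ zWord ℓIdx))

  zi : ℕ → ℕ → ℕ
  zi i j =
    if ((perm π (rIdx + i) ≤ᵇ perm π j) ∧ (i % 2 ≡ᵇ 0))
       ∨ ((perm π (ℓIdx + i) ≤ᵇ perm π j) ∧ (i % 2 ≡ᵇ 1))
    then suc (z j) else z j

-- infinite words over ℕ: w : ℕ → ℕ, letters at positions 1,2,3,… (w 0 unused)
-- suffix w_{[i,∞)} re-indexed from 1
suffix : (ℕ → ℕ) → ℕ → (ℕ → ℕ)
suffix w i k = w (i + k ∸ 1)

AltLt : (ℕ → ℕ) → (ℕ → ℕ) → Set
AltLt v w = ∃[ k ] (1 ≤ k
  × (∀ j → 1 ≤ j → j < k → v j ≡ w j)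
  × (k % 2 ≡ 1 → v k < w k)
  × (k % 2 ≡ 0 → w k < v k))

Pat : (ℕ → ℕ) → (n : ℕ) → Permutation′ n → Set
Pat w n π = ∀ j → 1 ≤ j → j < n →
  AltLt (suffix w (permInv π j)) (suffix w (permInv π (suc j)))

module Submission where

-- Write p = π(n), s = π⁻¹ and, for a rank v, W v = w(s v) and Z v = z(s v)
-- = #{ 1 ≤ i < v : zCond i }.  Comparing first
--    letters of suffixes at neighbouring ranks shows that W grows by at least
--    one wherever zCond counts an index; chaining along all ranks but p gives
--    Z b − Z a ≤ W b − W a (growth), and Z a = Z b forces the successors of
--    the positions of ranks a < b to have reversed ranks (reversal).  As
--    Z 1 = 0, also Z v ≤ W v.
--  * Collapsedness makes the z-word from ℓ (or r) a square of the one from r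
--    (or ℓ), with blocks of length d = |r − ℓ|.  A descent in the alternating
--    order (noSquareBetween) shows that w is not a square there, so
--    w(ℓ+t) ≠ w(r+t) for some t < d (record Square).
--  * Along the pairs (ℓ+t, r+t) the reversal lemma makes the ranks alternate
--    in orientation with the parity of t and enclose no rank but p.  If
--    W n ≤ Z n + 1, then Z ≤ W ≤ Z + 1 everywhere and the jump of W at the
--    pair t determines w as z^{(t)} on [1,n); this gives both the bound
--    w_m ≥ z_m + 1 and the characterisation of equality.
-- The file develops permutations as functions on ℕ, the alternating order
-- and its square-free descent, counting lemmas, induction along the ranks
-- with p removed, the bounds coming from a pattern (PatternBounds), and the
-- collapsed case (CollapsedAnalysis), from which lemma3 follows at once.

open import Defs
open import Data.Nat using (ℕ; zero; suc; _+_; _∸_; _≤_; _<_; _%_; _≟_; _≤?_; _<?_;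
  s≤s; z≤n; s≤s⁻¹; _≡ᵇ_; _<ᵇ_; _≤ᵇ_; ∣_-_∣)
open import Data.Nat.Properties
open import Data.Nat.Tactic.RingSolver using (solve-∀)
open import Data.Nat.Induction using (<-wellFounded)
open import Induction.WellFounded using (Acc; acc)
open import Data.Bool using (Bool; true; false; T; if_then_else_)
import Data.Bool
open import Data.Bool.Properties using (∨-identityʳ; ∧-identityʳ; ∧-zeroʳ)
open import Data.Fin using (toℕ; fromℕ<)
open import Data.Fin.Properties using (toℕ<n; fromℕ<-toℕ; toℕ-fromℕ<; ¬∀⟶∃¬)
open import Data.Fin.Permutation using (Permutation′; _⟨$⟩ʳ_; _⟨$⟩ˡ_; inverseˡ; inverseʳ)
open import Data.List using (List; []; _∷_; map; upTo; filter; length; _++_; [_]; applyUpTo)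
open import Data.List.Properties using (upTo-∷ʳ; map-++; filter-++; length-++;
  map-applyUpTo; length-map; length-upTo)
open import Data.Empty using (⊥; ⊥-elim)
open import Data.Unit using (tt)
open import Data.Sum using (_⊎_; inj₁; inj₂)
open import Data.Product using (_×_; _,_; proj₁; proj₂; Σ; ∃-syntax)
open import Function using (_∘_)
open import Function.Bundles using (_⇔_; mk⇔)
open import Relation.Binary using (tri<; tri≈; tri>)
open import Relation.Binary.PropositionalEquality hiding ([_])
open import Relation.Nullary using (Dec; yes; no; ¬_)

InRange : ℕ → ℕ → Set
InRange n j = 1 ≤ j × j ≤ n

module PermutationFacts {n : ℕ} (π : Permutation′ n) where

  perm-suc : ∀ j (j<n : j < n) → perm π (suc j) ≡ suc (toℕ (π ⟨$⟩ʳ fromℕ< j<n))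
  perm-suc j j<n with j <? n
  ... | yes q = cong (λ q → suc (toℕ (π ⟨$⟩ʳ fromℕ< q))) (<-irrelevant q j<n)
  ... | no ¬q = ⊥-elim (¬q j<n)

  permInv-suc : ∀ j (j<n : j < n) → permInv π (suc j) ≡ suc (toℕ (π ⟨$⟩ˡ fromℕ< j<n))
  permInv-suc j j<n with j <? n
  ... | yes q = cong (λ q → suc (toℕ (π ⟨$⟩ˡ fromℕ< q))) (<-irrelevant q j<n)
  ... | no ¬q = ⊥-elim (¬q j<n)

  perm≤n : ∀ j → perm π j ≤ n
  perm≤n zero = z≤n
  perm≤n (suc j) with j <? n
  ... | yes q = toℕ<n _
  ... | no _ = z≤n

  perm-inRange : ∀ {j} → InRange n j → InRange n (perm π j)
  perm-inRange {suc j} (_ , j≤n) rewrite perm-suc j j≤n = s≤s z≤n , toℕ<n _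

  permInv-inRange : ∀ {j} → InRange n j → InRange n (permInv π j)
  permInv-inRange {suc j} (_ , j≤n) rewrite permInv-suc j j≤n = s≤s z≤n , toℕ<n _

  permInv-perm : ∀ {j} → InRange n j → permInv π (perm π j) ≡ j
  permInv-perm {suc j} (_ , j≤n) rewrite perm-suc j j≤n = begin
      permInv π (suc (toℕ x))                  ≡⟨ permInv-suc (toℕ x) (toℕ<n x) ⟩
      suc (toℕ (π ⟨$⟩ˡ fromℕ< (toℕ<n x)))      ≡⟨ cong (λ y → suc (toℕ (π ⟨$⟩ˡ y))) (fromℕ<-toℕ x (toℕ<n x)) ⟩
      suc (toℕ (π ⟨$⟩ˡ x))                     ≡⟨ cong (suc ∘ toℕ) (inverseˡ π) ⟩
      suc (toℕ (fromℕ< j≤n))                   ≡⟨ cong suc (toℕ-fromℕ< j≤n) ⟩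
      suc j                                    ∎
    where open ≡-Reasoning
          x = π ⟨$⟩ʳ fromℕ< j≤n

  perm-permInv : ∀ {j} → InRange n j → perm π (permInv π j) ≡ j
  perm-permInv {suc j} (_ , j≤n) rewrite permInv-suc j j≤n = begin
      perm π (suc (toℕ x))                     ≡⟨ perm-suc (toℕ x) (toℕ<n x) ⟩
      suc (toℕ (π ⟨$⟩ʳ fromℕ< (toℕ<n x)))      ≡⟨ cong (λ y → suc (toℕ (π ⟨$⟩ʳ y))) (fromℕ<-toℕ x (toℕ<n x)) ⟩
      suc (toℕ (π ⟨$⟩ʳ x))                     ≡⟨ cong (suc ∘ toℕ) (inverseʳ π) ⟩
      suc (toℕ (fromℕ< j≤n))                   ≡⟨ cong suc (toℕ-fromℕ< j≤n) ⟩
      suc j                                    ∎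
    where open ≡-Reasoning
          x = π ⟨$⟩ˡ fromℕ< j≤n

  perm-injective : ∀ {i j} → InRange n i → InRange n j → perm π i ≡ perm π j → i ≡ j
  perm-injective ri rj e = trans (sym (permInv-perm ri)) (trans (cong (permInv π) e) (permInv-perm rj))

  permInv-injective : ∀ {i j} → InRange n i → InRange n j → permInv π i ≡ permInv π j → i ≡ j
  permInv-injective ri rj e = trans (sym (perm-permInv ri)) (trans (cong (perm π) e) (perm-permInv rj))

perm-last≢⇒n≥1 : ∀ {n} (π : Permutation′ n) → perm π n ≢ n → 1 ≤ n
perm-last≢⇒n≥1 {zero} π h = ⊥-elim (h refl)
perm-last≢⇒n≥1 {suc n} π h = s≤s z≤n

Seq : Set
Seq = ℕ → ℕ

parity : ∀ k → k % 2 ≡ 0 ⊎ k % 2 ≡ 1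
parity zero = inj₁ refl
parity (suc zero) = inj₂ refl
parity (suc (suc k)) = parity k

even⇒suc-odd : ∀ k → k % 2 ≡ 0 → suc k % 2 ≡ 1
even⇒suc-odd zero _ = refl
even⇒suc-odd (suc zero) ()
even⇒suc-odd (suc (suc k)) e = even⇒suc-odd k e

odd⇒suc-even : ∀ k → k % 2 ≡ 1 → suc k % 2 ≡ 0
odd⇒suc-even zero ()
odd⇒suc-even (suc zero) _ = refl
odd⇒suc-even (suc (suc k)) e = odd⇒suc-even k e

suc-even⇒odd : ∀ k → suc k % 2 ≡ 0 → k % 2 ≡ 1
suc-even⇒odd zero ()
suc-even⇒odd (suc zero) _ = refl
suc-even⇒odd (suc (suc k)) e = suc-even⇒odd k e

suc-odd⇒even : ∀ k → suc k % 2 ≡ 1 → k % 2 ≡ 0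
suc-odd⇒even zero _ = refl
suc-odd⇒even (suc zero) ()
suc-odd⇒even (suc (suc k)) e = suc-odd⇒even k e

LtAt : ℕ → Seq → Seq → Set
LtAt k v w = 1 ≤ k × (∀ j → 1 ≤ j → j < k → v j ≡ w j)
  × (k % 2 ≡ 1 → v k < w k) × (k % 2 ≡ 0 → w k < v k)

AgreeUpTo : ℕ → Seq → Seq → Set
AgreeUpTo k v v' = ∀ j → 1 ≤ j → j ≤ k → v j ≡ v' j

_≐_ : Seq → Seq → Set
v ≐ v' = ∀ j → 1 ≤ j → v j ≡ v' j

LtAt-differs : ∀ {k v w} → LtAt k v w → v k ≢ w k
LtAt-differs {k} (_ , _ , odd , even) eq with parity k
... | inj₁ e = <-irrefl (sym eq) (even e)
... | inj₂ o = <-irrefl eq (odd o)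

LtAt-resp : ∀ {k v w v' w'} → LtAt k v w → AgreeUpTo k v v' → AgreeUpTo k w w' → LtAt k v' w'
LtAt-resp {k} (k≥1 , eq , odd , even) av aw =
  k≥1 , (λ j j≥1 j<k → trans (sym (av j j≥1 (<⇒≤ j<k))) (trans (eq j j≥1 j<k) (aw j j≥1 (<⇒≤ j<k))))
      , (λ o → subst₂ _<_ (av k k≥1 ≤-refl) (aw k k≥1 ≤-refl) (odd o))
      , (λ e → subst₂ _<_ (aw k k≥1 ≤-refl) (av k k≥1 ≤-refl) (even e))

AltLt-resp : ∀ {v w v' w'} → AltLt v w → v ≐ v' → w ≐ w' → AltLt v' w'
AltLt-resp (k , A) av aw = k , LtAt-resp A (λ j j≥1 _ → av j j≥1) (λ j j≥1 _ → aw j j≥1)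

LtAt-asym : ∀ {k k' v w} → LtAt k v w → LtAt k' w v → ⊥
LtAt-asym {k} {k'} A@(k≥1 , eq , odd , even) B@(k'≥1 , eq' , odd' , even') with <-cmp k k'
... | tri< k<k' _ _ = LtAt-differs A (sym (eq' k k≥1 k<k'))
... | tri> _ _ k>k' = LtAt-differs B (sym (eq k' k'≥1 k>k'))
... | tri≈ _ refl _ with parity k
...   | inj₁ e = <-asym (even e) (even' e)
...   | inj₂ o = <-asym (odd o) (odd' o)

AltLt-asym : ∀ {v w} → AltLt v w → ¬ AltLt w v
AltLt-asym (_ , A) (_ , B) = LtAt-asym A B

AltLt-trans : ∀ {u v w} → AltLt u v → AltLt v w → AltLt u w
AltLt-trans (k , A@(k≥1 , eq , odd , even)) (k' , B@(k'≥1 , eq' , odd' , even')) with <-cmp k k'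
... | tri< k<k' _ _ = k , LtAt-resp A (λ _ _ _ → refl) (λ j j≥1 j≤k → eq' j j≥1 (≤-<-trans j≤k k<k'))
... | tri> _ _ k>k' = k' , LtAt-resp B (λ j j≥1 j≤k' → sym (eq j j≥1 (≤-<-trans j≤k' k>k'))) (λ _ _ _ → refl)
... | tri≈ _ refl _ = k , k≥1 , (λ j j≥1 j<k → trans (eq j j≥1 j<k) (eq' j j≥1 j<k))
       , (λ o → <-trans (odd o) (odd' o)) , (λ e → <-trans (even' e) (even e))

AltLt-head : ∀ {v w} → AltLt v w → v 1 ≤ w 1
AltLt-head (suc zero , _ , _ , odd , _) = <⇒≤ (odd refl)
AltLt-head (suc (suc k) , _ , eq , _ , _) = ≤-reflexive (eq 1 ≤-refl (s≤s (s≤s z≤n)))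

tail : Seq → Seq
tail v j = v (suc j)

LtAt-tail : ∀ {k v w} → LtAt (suc (suc k)) v w → LtAt (suc k) (tail w) (tail v)
LtAt-tail {k} (_ , eq , odd , even) =
  s≤s z≤n , (λ j _ j≤k → sym (eq (suc j) (s≤s z≤n) (s≤s j≤k)))
  , (λ o → even (suc-odd⇒even k o)) , (λ e → odd (suc-even⇒odd k e))

LtAt-beyond-head : ∀ {k v w} → LtAt k v w → v 1 ≡ w 1 → Σ ℕ λ k' → k ≡ suc (suc k')
LtAt-beyond-head {suc zero} A e = ⊥-elim (LtAt-differs A e)
LtAt-beyond-head {suc (suc k')} A e = k' , refl

AltLt-tail : ∀ {v w} → AltLt v w → v 1 ≡ w 1 → AltLt (tail w) (tail v)
AltLt-tail (k , A) e with LtAt-beyond-head A e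
... | k' , refl = suc k' , LtAt-tail A

suffix-head : ∀ (u : Seq) a → suffix u a 1 ≡ u a
suffix-head u a = cong u (m+n∸n≡m a 1)

suffix-tail : ∀ (u : Seq) a → tail (suffix u a) ≐ suffix u (suc a)
suffix-tail u a j _ = cong (λ i → u (i ∸ 1)) (+-suc a j)

suffix-head-≤ : ∀ (u : Seq) a b → AltLt (suffix u a) (suffix u b) → u a ≤ u b
suffix-head-≤ u a b lt = subst₂ _≤_ (suffix-head u a) (suffix-head u b) (AltLt-head lt)

suffix-tails-reversed : ∀ (u : Seq) a b → AltLt (suffix u a) (suffix u b) → u a ≡ u b
  → AltLt (suffix u (suc b)) (suffix u (suc a))
suffix-tails-reversed u a b lt e =
  AltLt-resp (AltLt-tail lt (trans (suffix-head u a) (trans e (sym (suffix-head u b)))))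
    (suffix-tail u b) (suffix-tail u a)

BetweenAt : ℕ → Seq → Seq → Seq → Set
BetweenAt k P R Q = (AltLt P R × LtAt k R Q) ⊎ (LtAt k Q R × AltLt R P)

BetweenAt-resp : ∀ {k P R Q P' R' Q'} → BetweenAt k P R Q → P ≐ P' → R ≐ R' → Q ≐ Q'
  → BetweenAt k P' R' Q'
BetweenAt-resp (inj₁ (PR , RQ)) p r q =
  inj₁ (AltLt-resp PR p r , LtAt-resp RQ (λ j j≥1 _ → r j j≥1) (λ j j≥1 _ → q j j≥1))
BetweenAt-resp (inj₂ (QR , RP)) p r q =
  inj₂ (LtAt-resp QR (λ j j≥1 _ → q j j≥1) (λ j j≥1 _ → r j j≥1) , AltLt-resp RP r p)

BetweenAt-agree : ∀ {k P R Q} → BetweenAt k P R Q → ∀ j → 1 ≤ j → j < k → R j ≡ Q j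
BetweenAt-agree (inj₁ (_ , (_ , eq , _))) j j≥1 j<k = eq j j≥1 j<k
BetweenAt-agree (inj₂ ((_ , eq , _) , _)) j j≥1 j<k = sym (eq j j≥1 j<k)

BetweenAt-tail : ∀ {k P R Q} → BetweenAt (suc (suc k)) P R Q → P 1 ≡ R 1
  → BetweenAt (suc k) (tail P) (tail R) (tail Q)
BetweenAt-tail (inj₁ (PR , RQ)) e = inj₂ (LtAt-tail RQ , AltLt-tail PR e)
BetweenAt-tail (inj₂ (QR , RP)) e = inj₁ (AltLt-tail RP (sym e) , LtAt-tail QR)

shift : ℕ → Seq → Seq
shift zero v = v
shift (suc d) v = shift d (tail v)

shift-at : ∀ d v j → shift d v j ≡ v (d + j)
shift-at zero v j = refl
shift-at (suc d) v j = shift-at d (tail v) j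

BetweenAt-shift : ∀ d k P R Q → BetweenAt k P R Q → d < k → AgreeUpTo d P R
  → BetweenAt (k ∸ d) (shift d P) (shift d R) (shift d Q)
BetweenAt-shift zero k P R Q B _ _ = B
BetweenAt-shift (suc d) (suc (suc k)) P R Q B (s≤s (s≤s d≤k)) agree =
  BetweenAt-shift d (suc k) (tail P) (tail R) (tail Q)
    (BetweenAt-tail B (agree 1 ≤-refl (s≤s z≤n))) (s≤s d≤k)
    (λ j _ j≤d → agree (suc j) (s≤s z≤n) (s≤s j≤d))

-- Descent: if P, Q = shift d P, R = shift d Q and P, Q agree on their first d
-- letters, then R is not between P and Q.  Otherwise the first difference
-- of R and Q is beyond d, and shifting by d gives the same configuration for
-- (Q, shift d R, R) with a smaller difference index; the parameter bounds it.
noBetweenShifts : ∀ d → 1 ≤ d → ∀ bound k P R Q → k ≤ bound → BetweenAt k P R Q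
  → shift d P ≐ Q → shift d Q ≐ R → AgreeUpTo d P Q → ⊥
noBetweenShifts d d≥1 bound k P R Q k≤bound B PQ QR agree with k ≤? d
... | yes k≤d with B
...   | inj₁ (PR , RQ) = AltLt-asym PR (k , LtAt-resp RQ (λ _ _ _ → refl) (λ j j≥1 j≤k → sym (agree j j≥1 (≤-trans j≤k k≤d))))
...   | inj₂ (QR , RP) = AltLt-asym (k , LtAt-resp QR (λ j j≥1 j≤k → sym (agree j j≥1 (≤-trans j≤k k≤d))) (λ _ _ _ → refl)) RP
noBetweenShifts d d≥1 bound k P R Q k≤bound B PQ QR agree | no k≰d = descend bound k≤bound
  where
  d<k : d < k
  d<k = ≰⇒> k≰d
  R≡Q : ∀ j → 1 ≤ j → j < k → R j ≡ Q j
  R≡Q = BetweenAt-agree B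
  B' : BetweenAt (k ∸ d) Q (shift d R) R
  B' = BetweenAt-resp
         (BetweenAt-shift d k P R Q B d<k (λ j j≥1 j≤d → trans (agree j j≥1 j≤d) (sym (R≡Q j j≥1 (≤-<-trans j≤d d<k)))))
         PQ (λ _ _ → refl) QR
  descend : ∀ bound → k ≤ bound → ⊥
  descend zero k≤0 = <-irrefl refl (<-≤-trans (≤-<-trans z≤n d<k) k≤0)
  descend (suc bound) k≤bound = noBetweenShifts d d≥1 bound (k ∸ d) Q (shift d R) R
    (≤-trans (∸-monoʳ-≤ k d≥1) (∸-monoˡ-≤ 1 k≤bound))
    B' QR (λ _ _ → refl) (λ j j≥1 j≤d → sym (R≡Q j j≥1 (≤-<-trans j≤d d<k)))

noSquareBetween : (u : Seq) (a b c d : ℕ) → 1 ≤ d → a + d ≡ b → b + d ≡ c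
  → (∀ t → t < d → u (a + t) ≡ u (b + t))
  → ¬ ((AltLt (suffix u a) (suffix u c) × AltLt (suffix u c) (suffix u b))
       ⊎ (AltLt (suffix u b) (suffix u c) × AltLt (suffix u c) (suffix u a)))
noSquareBetween u a b c d d≥1 a+d≡b b+d≡c repeat = λ
  { (inj₁ (PR , (k , RQ))) → descent k (inj₁ (PR , RQ))
  ; (inj₂ ((k , QR) , RP)) → descent k (inj₂ (QR , RP)) }
  where
  shifted : ∀ x y → x + d ≡ y → shift d (suffix u x) ≐ suffix u y
  shifted x y x+d≡y j _ =
    trans (shift-at d (suffix u x) j) (cong (λ i → u (i ∸ 1)) (trans (sym (+-assoc x d j)) (cong (_+ j) x+d≡y)))
  blocks : AgreeUpTo d (suffix u a) (suffix u b)
  blocks j j≥1 j≤d = begin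
      u (a + j ∸ 1)   ≡⟨ cong u (+-∸-assoc a j≥1) ⟩
      u (a + (j ∸ 1)) ≡⟨ repeat (j ∸ 1) (<-≤-trans (∸-monoˡ-< (n<1+n j) j≥1) j≤d) ⟩
      u (b + (j ∸ 1)) ≡⟨ cong u (sym (+-∸-assoc b j≥1)) ⟩
      u (b + j ∸ 1)   ∎
    where open ≡-Reasoning
  descent : ∀ k → BetweenAt k (suffix u a) (suffix u c) (suffix u b) → ⊥
  descent k B = noBetweenShifts d d≥1 k k (suffix u a) (suffix u c) (suffix u b) ≤-refl B
    (shifted a b a+d≡b) (shifted b c b+d≡c) blocks

indicator : Bool → ℕ
indicator true = 1
indicator false = 0

-- count f k = #{ 1 ≤ i ≤ k : f i }; note  z π j = count (zCond π) (π(j) − 1).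
count : (ℕ → Bool) → ℕ → ℕ
count f k = length (filter (λ i → f i Data.Bool.≟ true) (map (1 +_) (upTo k)))

count-suc : ∀ f k → count f (suc k) ≡ count f k + indicator (f (suc k))
count-suc f k = begin
    length (filter P? (map (1 +_) (upTo (suc k))))
      ≡⟨ cong (λ l → length (filter P? (map (1 +_) l))) (sym (upTo-∷ʳ k)) ⟩
    length (filter P? (map (1 +_) (upTo k ++ [ k ])))
      ≡⟨ cong (length ∘ filter P?) (map-++ (1 +_) (upTo k) [ k ]) ⟩
    length (filter P? (map (1 +_) (upTo k) ++ [ suc k ]))
      ≡⟨ cong length (filter-++ P? (map (1 +_) (upTo k)) [ suc k ]) ⟩
    length (filter P? (map (1 +_) (upTo k)) ++ filter P? [ suc k ])
      ≡⟨ length-++ (filter P? (map (1 +_) (upTo k))) ⟩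
    count f k + length (filter P? [ suc k ])
      ≡⟨ cong (count f k +_) (singleton (f (suc k)) refl) ⟩
    count f k + indicator (f (suc k)) ∎
  where
  open ≡-Reasoning
  P? = λ i → f i Data.Bool.≟ true
  singleton : ∀ b → f (suc k) ≡ b → length (filter P? [ suc k ]) ≡ indicator b
  singleton true e rewrite e = refl
  singleton false e rewrite e = refl

count-pred : ∀ f k → 1 ≤ k → count f k ≡ count f (k ∸ 1) + indicator (f k)
count-pred f (suc k) _ = count-suc f k

count-mono : ∀ f {i j} → i ≤ j → count f i ≤ count f j
count-mono f {i} {j} i≤j with m≤n⇒m<n∨m≡n i≤j
... | inj₂ refl = ≤-refl
count-mono f {i} {suc j} i≤j | inj₁ (s≤s i≤j') =
  ≤-trans (count-mono f i≤j') (≤-trans (m≤m+n (count f j) _) (≤-reflexive (sym (count-suc f j))))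

at : List ℕ → ℕ → ℕ
at [] _ = 0
at (x ∷ xs) zero = x
at (x ∷ xs) (suc t) = at xs t

at-++ˡ : ∀ xs ys t → t < length xs → at (xs ++ ys) t ≡ at xs t
at-++ˡ (x ∷ xs) ys zero _ = refl
at-++ˡ (x ∷ xs) ys (suc t) (s≤s t<) = at-++ˡ xs ys t t<

at-applyUpTo : ∀ (g : ℕ → ℕ) L t → t < L → at (applyUpTo g L) t ≡ g t
at-applyUpTo g (suc L) zero _ = refl
at-applyUpTo g (suc L) (suc t) (s≤s t<L) = at-applyUpTo (g ∘ suc) L t t<L

values : (ℕ → ℕ) → ℕ → ℕ → List ℕ
values f a L = map f (map (a +_) (upTo L))

at-values : ∀ f a L t → t < L → at (values f a L) t ≡ f (a + t)
at-values f a L t t<L = begin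
    at (map f (map (a +_) (upTo L))) t
      ≡⟨ cong (λ l → at (map f l) t) (map-applyUpTo (λ x → x) (a +_) L) ⟩
    at (map f (applyUpTo (a +_) L)) t
      ≡⟨ cong (λ l → at l t) (map-applyUpTo (a +_) f L) ⟩
    at (applyUpTo (f ∘ (a +_)) L) t
      ≡⟨ at-applyUpTo (f ∘ (a +_)) L t t<L ⟩
    f (a + t) ∎
  where open ≡-Reasoning

length-values : ∀ f a L → length (values f a L) ≡ L
length-values f a L = trans (length-map f (map (a +_) (upTo L))) (trans (length-map (a +_) (upTo L)) (length-upTo L))

squareValues : (f : ℕ → ℕ) (n x y : ℕ) → x ≤ n → y < n
  → map f (range x n) ≡ map f (range y n) ++ map f (range y n)
  → Σ ℕ λ d → 1 ≤ d × x + d ≡ y × y + d ≡ n × (∀ t → t < d → f (x + t) ≡ f (y + t))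
squareValues f n x y x≤n y<n square = d , m<n⇒0<n∸m y<n , x+d≡y , y+d≡n , sameValues
  where
  d = n ∸ y
  twice : n ∸ x ≡ d + d
  twice = begin
      n ∸ x                                  ≡⟨ sym (length-values f x (n ∸ x)) ⟩
      length (values f x (n ∸ x))            ≡⟨ cong length square ⟩
      length (values f y d ++ values f y d)  ≡⟨ length-++ (values f y d) ⟩
      length (values f y d) + length (values f y d)
        ≡⟨ cong₂ _+_ (length-values f y d) (length-values f y d) ⟩
      d + d                                  ∎
    where open ≡-Reasoning
  y+d≡n : y + d ≡ n
  y+d≡n = m+[n∸m]≡n (<⇒≤ y<n)
  x+d≡y : x + d ≡ y
  x+d≡y = +-cancelʳ-≡ d (x + d) y
    (trans (+-assoc x d d) (trans (cong (x +_) (sym twice)) (trans (m+[n∸m]≡n x≤n) (sym y+d≡n))))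
  sameValues : ∀ t → t < d → f (x + t) ≡ f (y + t)
  sameValues t t<d = begin
      f (x + t)                             ≡⟨ sym (at-values f x (n ∸ x) t (subst (t <_) (sym twice) (≤-trans t<d (m≤m+n d d)))) ⟩
      at (values f x (n ∸ x)) t             ≡⟨ cong (λ l → at l t) square ⟩
      at (values f y d ++ values f y d) t   ≡⟨ at-++ˡ (values f y d) (values f y d) t (subst (t <_) (sym (length-values f y d)) t<d) ⟩
      at (values f y d) t                   ≡⟨ at-values f y d t t<d ⟩
      f (y + t)                             ∎
    where open ≡-Reasoning

+1≡suc : ∀ i → i + 1 ≡ suc i
+1≡suc i = +-comm i 1

pred≢ : ∀ {p} → 1 ≤ p → p ∸ 1 ≢ p
pred≢ {suc q} _ = 1+n≢n ∘ sym

-- Neighbouring ranks in the chain 1 < 2 < … < n from which the rank p is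
-- removed: (k, k+1) away from p, and (p−1, p+1) across the gap.
data Neighbours (n p : ℕ) : ℕ → ℕ → Set where
  step : ∀ k → 1 ≤ k → suc k ≤ n → k ≢ p → suc k ≢ p → Neighbours n p k (suc k)
  gap  : 2 ≤ p → suc p ≤ n → Neighbours n p (p ∸ 1) (suc p)

record ChainPair (n p a b : ℕ) : Set where
  field
    first-inRange  : InRange n a
    second-inRange : InRange n b
    first≢p        : a ≢ p
    second≢p       : b ≢ p
    first<second   : a < b

neighbours-chainPair : ∀ {n p a b} → Neighbours n p a b → ChainPair n p a b
neighbours-chainPair (step k k≥1 k<n k≢p k+1≢p) =
  record { first-inRange = k≥1 , <⇒≤ k<n ; second-inRange = s≤s z≤n , k<n
         ; first≢p = k≢p ; second≢p = k+1≢p ; first<second = ≤-refl }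
neighbours-chainPair {p = suc q} (gap p≥2 p<n) =
  record { first-inRange = s≤s⁻¹ p≥2 , ≤-trans (n≤1+n q) (<⇒≤ p<n) ; second-inRange = s≤s z≤n , p<n
         ; first≢p = pred≢ (s≤s z≤n) ; second≢p = 1+n≢n ; first<second = ≤-trans (n≤1+n (suc q)) ≤-refl }

module RankChain (n p : ℕ) (S : ℕ → ℕ → Set)
  (S-trans : ∀ a b c → S a b → S b c → S a c)
  (S-neighbours : ∀ {a b} → Neighbours n p a b → S a b) where

  private
    go : ∀ {b} → Acc _<_ b → ∀ a → 1 ≤ a → a < b → b ≤ n → a ≢ p → b ≢ p → S a b
    go {suc b'} (acc rec) a a≥1 (s≤s a≤b') b≤n a≢p b≢p with b' ≟ p
    ... | yes refl = viaGap (≤∧≢⇒< a≤b' a≢p)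
      where
      across : a < p → S (p ∸ 1) (suc p)
      across a<p = S-neighbours (gap (≤-trans (s≤s a≥1) a<p) b≤n)
      viaGap : a < p → S a (suc p)
      viaGap a<p with m≤n⇒m<n∨m≡n (∸-monoˡ-≤ 1 a<p)
      ... | inj₂ a≡p-1 = subst (λ x → S x (suc p)) (sym a≡p-1) (across a<p)
      ... | inj₁ a<p-1 = S-trans a (p ∸ 1) (suc p)
              (go (rec (s≤s (m∸n≤m p 1))) a a≥1 a<p-1 (≤-trans (m∸n≤m p 1) (<⇒≤ b≤n)) a≢p
                  (pred≢ (≤-trans (s≤s z≤n) a<p)))
              (across a<p)
    go {suc b'} (acc rec) a a≥1 (s≤s a≤b') b≤n a≢p b≢p | no b'≢p with m≤n⇒m<n∨m≡n a≤b'
    ... | inj₂ refl = S-neighbours (step a a≥1 b≤n a≢p b≢p)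
    ... | inj₁ a<b' = S-trans a b' (suc b')
            (go (rec ≤-refl) a a≥1 a<b' (<⇒≤ b≤n) a≢p b'≢p)
            (S-neighbours (step b' (≤-trans a≥1 (<⇒≤ a<b')) b≤n b'≢p b≢p))

  chain : ∀ a b → 1 ≤ a → a < b → b ≤ n → a ≢ p → b ≢ p → S a b
  chain a b = go (<-wellFounded b) a

≡ᵇ-true : ∀ {m n} → m ≡ n → (m ≡ᵇ n) ≡ true
≡ᵇ-true {m} {n} e with m ≡ᵇ n in eq
... | true = refl
... | false = ⊥-elim (subst T eq (≡⇒≡ᵇ m n e))

≡ᵇ-false : ∀ {m n} → m ≢ n → (m ≡ᵇ n) ≡ false
≡ᵇ-false {m} {n} m≢n with m ≡ᵇ n in eq
... | true = ⊥-elim (m≢n (≡ᵇ⇒≡ m n (subst T (sym eq) tt)))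
... | false = refl

<ᵇ-true⇒< : ∀ {m n} → (m <ᵇ n) ≡ true → m < n
<ᵇ-true⇒< {m} {n} e = <ᵇ⇒< m n (subst T (sym e) tt)

<ᵇ-false⇒≮ : ∀ {m n} → (m <ᵇ n) ≡ false → ¬ (m < n)
<ᵇ-false⇒≮ e m<n = subst T e (<⇒<ᵇ m<n)

if-true : ∀ {b} {x y : ℕ} → T b → (if b then x else y) ≡ x
if-true {true} _ = refl

-- Transitivity of the "growth" relation  Z b − Z a ≤ W b − W a,
-- written without subtraction.
growth-trans : ∀ z₁ z₂ z₃ w₁ w₂ w₃ → z₂ + w₁ ≤ z₁ + w₂ → z₃ + w₂ ≤ z₂ + w₃ → z₃ + w₁ ≤ z₁ + w₃
growth-trans z₁ z₂ z₃ w₁ w₂ w₃ h₁ h₂ = +-cancelˡ-≤ (z₂ + w₂) (z₃ + w₁) (z₁ + w₃)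
  (subst₂ _≤_ (rearrange₁ z₁ z₂ z₃ w₁ w₂ w₃) (rearrange₂ z₁ z₂ z₃ w₁ w₂ w₃) (+-mono-≤ h₂ h₁))
  where
  rearrange₁ : ∀ z₁ z₂ z₃ w₁ w₂ w₃ → (z₃ + w₂) + (z₂ + w₁) ≡ (z₂ + w₂) + (z₃ + w₁)
  rearrange₁ = solve-∀
  rearrange₂ : ∀ z₁ z₂ z₃ w₁ w₂ w₃ → (z₂ + w₃) + (z₁ + w₂) ≡ (z₂ + w₂) + (z₁ + w₃)
  rearrange₂ = solve-∀

StrictlyBetween : ℕ → ℕ → ℕ → Set
StrictlyBetween α v β = (α < v × v < β) ⊎ (β < v × v < α)

StrictlyBetween-sym : ∀ {α v β} → StrictlyBetween α v β → StrictlyBetween β v α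
StrictlyBetween-sym (inj₁ h) = inj₂ h
StrictlyBetween-sym (inj₂ h) = inj₁ h

onlyBetween⇒adjacent : ∀ {α β p} → (∀ v → StrictlyBetween α v β → v ≡ p) → α < p → p < β
  → α ≡ p ∸ 1 × β ≡ suc p
onlyBetween⇒adjacent {α} {β} {p} only α<p p<β = lower , upper
  where
  lower : α ≡ p ∸ 1
  lower with m≤n⇒m<n∨m≡n (∸-monoˡ-≤ 1 α<p)
  ... | inj₂ e = e
  ... | inj₁ α<p-1 = ⊥-elim (pred≢ (≤-<-trans z≤n α<p)
                       (only (p ∸ 1) (inj₁ (α<p-1 , ≤-<-trans (m∸n≤m p 1) p<β))))
  upper : β ≡ suc p
  upper with m≤n⇒m<n∨m≡n p<β
  ... | inj₂ e = sym e
  ... | inj₁ p+1<β = ⊥-elim (1+n≢n (only (suc p) (inj₁ (<-trans α<p ≤-refl , p+1<β))))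

nothingBetween-suc : ∀ α v → ¬ StrictlyBetween α v (suc α)
nothingBetween-suc α v (inj₁ (α<v , v<α+1)) = <-irrefl refl (<-≤-trans α<v (s≤s⁻¹ v<α+1))
nothingBetween-suc α v (inj₂ (α+1<v , v<α)) = <-asym (<-trans v<α ≤-refl) α+1<v

nothingBetweenConsecutive : ∀ {α β} → α ≡ suc β ⊎ β ≡ suc α → ∀ v → ¬ StrictlyBetween α v β
nothingBetweenConsecutive {β = β} (inj₁ refl) v = nothingBetween-suc β v ∘ StrictlyBetween-sym
nothingBetweenConsecutive {α = α} (inj₂ refl) v = nothingBetween-suc α v

boundedCounterexample : ∀ {P : ℕ → Set} → (∀ t → Dec (P t)) → ∀ d
  → ¬ (∀ t → t < d → P t) → ∃[ t ] (t < d × ¬ P t)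
boundedCounterexample {P} P? d notAll
  with ¬∀⟶∃¬ d (P ∘ toℕ) (P? ∘ toℕ) (λ all → notAll (λ t t<d → subst P (toℕ-fromℕ< t<d) (all (fromℕ< t<d))))
... | i , ¬Pi = toℕ i , toℕ<n i , ¬Pi

-- Consequences of Pat w n π when 1 < π(n) < n.  Ranks are compared through
-- W v = w(π⁻¹ v) and Z v = z(π⁻¹ v) = #{ 1 ≤ i < v : zCond i }.
module PatternBounds {n : ℕ} (π : Permutation′ n) (w : Seq) (pat : Pat w n π)
  (p≢1 : perm π n ≢ 1) (p≢n : perm π n ≢ n) where
  open PermutationFacts π

  p : ℕ
  p = perm π n

  s : ℕ → ℕ
  s = permInv π

  W : ℕ → ℕ
  W v = w (s v)

  Z : ℕ → ℕ
  Z v = count (zCond π) (v ∸ 1)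

  n≥1 : 1 ≤ n
  n≥1 = perm-last≢⇒n≥1 π p≢n

  n-inRange : InRange n n
  n-inRange = n≥1 , ≤-refl

  p-inRange : InRange n p
  p-inRange = perm-inRange n-inRange

  p≥2 : 2 ≤ p
  p≥2 = ≤∧≢⇒< (proj₁ p-inRange) (p≢1 ∘ sym)

  p<n : p < n
  p<n = ≤∧≢⇒< (proj₂ p-inRange) p≢n

  s<n : ∀ {v} → InRange n v → v ≢ p → s v < n
  s<n v-in v≢p = ≤∧≢⇒< (proj₂ (permInv-inRange v-in))
    (λ e → v≢p (trans (sym (perm-permInv v-in)) (cong (perm π) e)))

  rankOrder : ∀ x y → 1 ≤ x → x < y → y ≤ n → AltLt (suffix w (s x)) (suffix w (s y))
  rankOrder x (suc y) x≥1 (s≤s x≤y) y<n with m≤n⇒m<n∨m≡n x≤y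
  ... | inj₂ refl = pat x x≥1 y<n
  ... | inj₁ x<y = AltLt-trans (rankOrder x y x≥1 x<y (<⇒≤ y<n)) (pat y (≤-trans x≥1 (<⇒≤ x<y)) y<n)

  positionOrder : ∀ {a b} → InRange n a → InRange n b → perm π a < perm π b
    → AltLt (suffix w a) (suffix w b)
  positionOrder {a} {b} a-in b-in lt =
    subst₂ (λ x y → AltLt (suffix w x) (suffix w y)) (permInv-perm a-in) (permInv-perm b-in)
      (rankOrder (perm π a) (perm π b) (proj₁ (perm-inRange a-in)) lt (perm≤n b))

  positionOrder⁻ : ∀ {a b} → InRange n a → InRange n b → AltLt (suffix w a) (suffix w b)
    → perm π a < perm π b
  positionOrder⁻ {a} {b} a-in b-in lt with <-cmp (perm π a) (perm π b)
  ... | tri< a<b _ _ = a<b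
  ... | tri≈ _ e _ with perm-injective a-in b-in e
  ...   | refl = ⊥-elim (AltLt-asym lt lt)
  positionOrder⁻ a-in b-in lt | tri> _ _ a>b = ⊥-elim (AltLt-asym lt (positionOrder b-in a-in a>b))

  next-inRange : ∀ {v} → InRange n v → v ≢ p → InRange n (suc (s v))
  next-inRange v-in v≢p = s≤s z≤n , s<n v-in v≢p

  next-distinct : ∀ {a b} → ChainPair n p a b → perm π (suc (s a)) ≢ perm π (suc (s b))
  next-distinct cp e = <-irrefl (permInv-injective first-inRange second-inRange
      (suc-injective (perm-injective (next-inRange first-inRange first≢p) (next-inRange second-inRange second≢p) e)))
    first<second
    where open ChainPair cp

  p-1+1≡p : (p ∸ 1) + 1 ≡ p
  p-1+1≡p = m∸n+n≡m (≤-trans (s≤s z≤n) p≥2)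

  zCond-p : zCond π p ≡ false
  zCond-p rewrite ≡ᵇ-true {p} refl | ≡ᵇ-false {p + 1} {p} (λ e → 1+n≢n (trans (sym (+1≡suc p)) e)) = refl

  zCond-neighbours : ∀ {a b} → Neighbours n p a b
    → zCond π a ≡ (perm π (suc (s a)) <ᵇ perm π (suc (s b)))
  zCond-neighbours (step k _ _ k≢p k+1≢p)
    rewrite ≡ᵇ-false k≢p | ≡ᵇ-false (λ e → k+1≢p (trans (sym (+1≡suc k)) (sym e)))
          | ≡ᵇ-false (λ e → k+1≢p (trans (sym (+1≡suc k)) e)) =
    trans (∨-identityʳ _)
      (cong₂ (λ x y → perm π x <ᵇ perm π y) (+1≡suc (s k)) (trans (+1≡suc (s (k + 1))) (cong (suc ∘ s) (+1≡suc k))))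
  zCond-neighbours (gap _ _)
    rewrite ≡ᵇ-false (pred≢ (≤-trans (s≤s z≤n) p≥2)) | ≡ᵇ-true (sym p-1+1≡p) | ≡ᵇ-true p-1+1≡p | ≡ᵇ-false p≢n =
    cong₂ (λ x y → perm π x <ᵇ perm π y) (+1≡suc (s (p ∸ 1))) (trans (+1≡suc (s (p + 1))) (cong (suc ∘ s) (+1≡suc p)))

  Z-neighbours : ∀ {a b} → Neighbours n p a b → Z b ≡ Z a + indicator (zCond π a)
  Z-neighbours (step k k≥1 _ _ _) = count-pred (zCond π) k k≥1
  Z-neighbours (gap p≥2 _) = begin
      count (zCond π) p                                          ≡⟨ count-pred (zCond π) p (≤-trans (s≤s z≤n) p≥2) ⟩
      count (zCond π) (p ∸ 1) + indicator (zCond π p)            ≡⟨ cong (λ b → count (zCond π) (p ∸ 1) + indicator b) zCond-p ⟩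
      count (zCond π) (p ∸ 1) + 0                                ≡⟨ +-identityʳ _ ⟩
      count (zCond π) (p ∸ 1)                                    ≡⟨ count-pred (zCond π) (p ∸ 1) (∸-monoˡ-≤ 1 p≥2) ⟩
      Z (p ∸ 1) + indicator (zCond π (p ∸ 1))                    ∎
    where open ≡-Reasoning

  -- Neighbouring ranks: the suffixes at their positions are ordered, hence
  -- so are the first letters, strictly if the successors are not reversed.
  neighbourOrder : ∀ {a b} → ChainPair n p a b → AltLt (suffix w (s a)) (suffix w (s b))
  neighbourOrder cp = rankOrder _ _ (proj₁ first-inRange) first<second (proj₂ second-inRange)
    where open ChainPair cp

  neighbourStep : ∀ {a b} → Neighbours n p a b → W a + indicator (zCond π a) ≤ W b
  neighbourStep {a} {b} nb with zCond π a in counted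
  ... | false = subst (_≤ W b) (sym (+-identityʳ (W a))) (suffix-head-≤ w (s a) (s b) (neighbourOrder cp))
    where cp = neighbours-chainPair nb
  ... | true = subst (_≤ W b) (+-comm 1 (W a)) (≤∧≢⇒< (suffix-head-≤ w (s a) (s b) ordered) λ e →
        <-asym (positionOrder⁻ (next-inRange second-inRange second≢p) (next-inRange first-inRange first≢p)
                  (suffix-tails-reversed w (s a) (s b) ordered e))
               (<ᵇ-true⇒< (trans (sym (zCond-neighbours nb)) counted)))
    where cp = neighbours-chainPair nb
          open ChainPair cp
          ordered = neighbourOrder cp

  neighbourReversal : ∀ {a b} → Neighbours n p a b → Z a ≡ Z b → perm π (suc (s b)) < perm π (suc (s a))
  neighbourReversal {a} {b} nb Za≡Zb =
    ≤∧≢⇒< (≮⇒≥ (<ᵇ-false⇒≮ (trans (sym (zCond-neighbours nb)) notCounted)))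
          (next-distinct (neighbours-chainPair nb) ∘ sym)
    where
    notCounted : zCond π a ≡ false
    notCounted with zCond π a | Z-neighbours nb
    ... | false | _ = refl
    ... | true | Zb≡Za+1 = ⊥-elim (<-irrefl (trans Za≡Zb Zb≡Za+1) (m<m+n (Z a) (s≤s z≤n)))

  Z-mono : ∀ {a b} → a ≤ b → Z a ≤ Z b
  Z-mono a≤b = count-mono (zCond π) (∸-monoˡ-≤ 1 a≤b)

  -- Growth a b:  Z b − Z a ≤ W b − W a.
  Growth : ℕ → ℕ → Set
  Growth a b = Z b + W a ≤ Z a + W b

  growth : ∀ a b → 1 ≤ a → a < b → b ≤ n → a ≢ p → b ≢ p → Growth a b
  growth = RankChain.chain n p Growth
    (λ a b c → growth-trans (Z a) (Z b) (Z c) (W a) (W b) (W c))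
    (λ {a} {b} nb → subst (_≤ Z a + W b)
       (trans (sym (reassoc (Z a) (indicator (zCond π a)) (W a))) (cong (_+ W a) (sym (Z-neighbours nb))))
       (+-monoʳ-≤ (Z a) (neighbourStep nb)))
    where
    reassoc : ∀ x i y → (x + i) + y ≡ x + (y + i)
    reassoc = solve-∀

  Reversed : ℕ → ℕ → Set
  Reversed a b = a ≤ b × (Z a ≡ Z b → perm π (suc (s b)) < perm π (suc (s a)))

  reversal : ∀ a b → 1 ≤ a → a < b → b ≤ n → a ≢ p → b ≢ p → Z a ≡ Z b
    → perm π (suc (s b)) < perm π (suc (s a))
  reversal a b a≥1 a<b b≤n a≢p b≢p = proj₂ (RankChain.chain n p Reversed reversed-trans
    (λ nb → <⇒≤ (ChainPair.first<second (neighbours-chainPair nb)) , neighbourReversal nb)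
    a b a≥1 a<b b≤n a≢p b≢p)
    where
    reversed-trans : ∀ a b c → Reversed a b → Reversed b c → Reversed a c
    reversed-trans a b c (a≤b , rev₁) (b≤c , rev₂) = ≤-trans a≤b b≤c , λ Za≡Zc →
      let Za≡Zb = ≤-antisym (Z-mono a≤b) (subst (Z b ≤_) (sym Za≡Zc) (Z-mono b≤c))
      in <-trans (rev₂ (trans (sym Za≡Zb) Za≡Zc)) (rev₁ Za≡Zb)

  -- Lower bound: Z v ≤ W v, since Z 1 = 0.
  Z≤W : ∀ v → InRange n v → v ≢ p → Z v ≤ W v
  Z≤W v (v≥1 , v≤n) v≢p with m≤n⇒m<n∨m≡n v≥1
  ... | inj₂ refl = z≤n
  ... | inj₁ 1<v = ≤-trans (m≤m+n (Z v) (W 1)) (growth 1 v ≤-refl 1<v v≤n (p≢1 ∘ sym) v≢p)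

  ℓ : ℕ
  ℓ = ℓIdx π

  r : ℕ
  r = rIdx π

  private
    p-1-inRange : InRange n (p ∸ 1)
    p-1-inRange = ∸-monoˡ-≤ 1 p≥2 , ≤-trans (m∸n≤m p 1) (proj₂ p-inRange)

    p+1-inRange : InRange n (p + 1)
    p+1-inRange = m≤n+m 1 p , subst (_≤ n) (sym (+1≡suc p)) p<n

  perm-ℓ : perm π ℓ ≡ p ∸ 1
  perm-ℓ = perm-permInv p-1-inRange

  perm-r : perm π r ≡ suc p
  perm-r = trans (perm-permInv p+1-inRange) (+1≡suc p)

  ℓ-inRange : InRange n ℓ
  ℓ-inRange = permInv-inRange p-1-inRange

  r-inRange : InRange n r
  r-inRange = permInv-inRange p+1-inRange

  ℓ<n : ℓ < n
  ℓ<n = s<n p-1-inRange (pred≢ (≤-trans (s≤s z≤n) p≥2))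

  r<n : r < n
  r<n = s<n p+1-inRange (λ e → 1+n≢n (trans (sym (+1≡suc p)) e))

  ℓ<n<r : AltLt (suffix w ℓ) (suffix w n) × AltLt (suffix w n) (suffix w r)
  ℓ<n<r = positionOrder ℓ-inRange n-inRange (subst (_< p) (sym perm-ℓ) (∸-monoʳ-< {o = 0} (s≤s z≤n) (≤-trans (s≤s z≤n) p≥2)))
        , positionOrder n-inRange r-inRange (subst (p <_) (sym perm-r) ≤-refl)

  perm≢p : ∀ {x} → InRange n x → x < n → perm π x ≢ p
  perm≢p x-in x<n e = <-irrefl (perm-injective x-in n-inRange e) x<n

  positionReversal : ∀ {x y} → InRange n x → x < n → InRange n y → y < n
    → perm π x < perm π y → Z (perm π x) ≡ Z (perm π y) → perm π (suc y) < perm π (suc x)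
  positionReversal {x} {y} x-in x<n y-in y<n lt same =
    subst₂ (λ a b → perm π (suc a) < perm π (suc b)) (permInv-perm y-in) (permInv-perm x-in)
      (reversal (perm π x) (perm π y) (proj₁ (perm-inRange x-in)) lt (perm≤n y)
                (perm≢p x-in x<n) (perm≢p y-in y<n) same)

  -- Between positions x, y < n of equal Z, a rank v ≠ p strictly between
  -- their ranks has the same Z, so its successor lies between their
  -- successors, in reversed order.
  successorBetween : ∀ {x y v} → InRange n x → x < n → InRange n y → y < n
    → perm π x < v → v < perm π y → v ≢ p → Z (perm π x) ≡ Z (perm π y)
    → perm π (suc y) < perm π (suc (s v)) × perm π (suc (s v)) < perm π (suc x)
  successorBetween {x} {y} {v} x-in x<n y-in y<n x<v v<y v≢p same =
    positionReversal v-pos (s<n v-in v≢p) y-in y<n (subst (_< perm π y) (sym v-rank) v<y)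
      (trans (cong Z v-rank) (trans (sym Zx≡Zv) same))
    , positionReversal x-in x<n v-pos (s<n v-in v≢p) (subst (perm π x <_) (sym v-rank) x<v)
      (trans Zx≡Zv (sym (cong Z v-rank)))
    where
    v-in : InRange n v
    v-in = ≤-<-trans z≤n x<v , ≤-trans (<⇒≤ v<y) (perm≤n y)
    v-pos = permInv-inRange v-in
    v-rank = perm-permInv v-in
    Zx≡Zv : Z (perm π x) ≡ Z v
    Zx≡Zv = ≤-antisym (Z-mono (<⇒≤ x<v)) (subst (Z v ≤_) (sym same) (Z-mono (<⇒≤ v<y)))

  -- Under the hypothesis W n ≤ Z n + 1 the growth bound pins W down to
  -- Z or Z + 1 everywhere, and a single jump of W between ranks of equal Z
  -- determines W completely.
  module UnderUpperBound (H : W n ≤ Z n + 1) where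

    W≤Z+1 : ∀ v → InRange n v → v ≢ p → W v ≤ Z v + 1
    W≤Z+1 v (v≥1 , v≤n) v≢p with m≤n⇒m<n∨m≡n v≤n
    ... | inj₂ refl = H
    ... | inj₁ v<n = +-cancelˡ-≤ (Z n) (W v) (Z v + 1)
      (≤-trans (growth v n v≥1 v<n ≤-refl v≢p (p≢n ∘ sym))
        (≤-trans (+-monoʳ-≤ (Z v) H) (≤-reflexive (swap (Z n) (Z v)))))
      where swap : ∀ A C → C + (A + 1) ≡ A + (C + 1)
            swap = solve-∀

    belowJump : ∀ {u vl} → InRange n u → u ≢ p → vl ≢ p → u < vl → vl ≤ n → W vl ≡ Z vl → W u ≡ Z u
    belowJump {u} {vl} (u≥1 , u≤n) u≢p vl≢p u<vl vl≤n Wvl≡Zvl = ≤-antisym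
      (+-cancelˡ-≤ (Z vl) (W u) (Z u)
        (≤-trans (growth u vl u≥1 u<vl vl≤n u≢p vl≢p) (≤-reflexive (trans (cong (Z u +_) Wvl≡Zvl) (+-comm (Z u) (Z vl))))))
      (Z≤W u (u≥1 , u≤n) u≢p)

    aboveJump : ∀ {vh u} → 1 ≤ vh → vh ≢ p → InRange n u → u ≢ p → vh < u → W vh ≡ suc (Z vh) → W u ≡ suc (Z u)
    aboveJump {vh} {u} vh≥1 vh≢p u-in u≢p vh<u Wvh≡ = ≤-antisym
      (subst (W u ≤_) (+-comm (Z u) 1) (W≤Z+1 u u-in u≢p))
      (+-cancelˡ-≤ (Z vh) (suc (Z u)) (W u)
        (subst (_≤ Z vh + W u) (trans (cong (Z u +_) Wvh≡) (swap (Z u) (Z vh)))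
          (growth vh u vh≥1 vh<u (proj₂ u-in) vh≢p u≢p)))
      where swap : ∀ A C → A + suc C ≡ C + suc A
            swap = solve-∀

    jump : ∀ {vl vh} → InRange n vl → vl ≢ p → InRange n vh → vh ≢ p → vl < vh → Z vl ≡ Z vh → W vl ≢ W vh
      → W vl ≡ Z vl × W vh ≡ suc (Z vh)
    jump {vl} {vh} vl-in vl≢p vh-in vh≢p vl<vh same differ = low , high
      where
      Wvl<Wvh : W vl < W vh
      Wvl<Wvh = ≤∧≢⇒< (+-cancelˡ-≤ (Z vh) (W vl) (W vh)
        (subst (λ q → Z vh + W vl ≤ q + W vh) same (growth vl vh (proj₁ vl-in) vl<vh (proj₂ vh-in) vl≢p vh≢p))) differ
      low : W vl ≡ Z vl
      low = ≤-antisym (s≤s⁻¹ (≤-trans Wvl<Wvh (≤-trans (W≤Z+1 vh vh-in vh≢p)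
              (≤-reflexive (trans (+-comm (Z vh) 1) (cong suc (sym same)))))))
            (Z≤W vl vl-in vl≢p)
      high : W vh ≡ suc (Z vh)
      high = ≤-antisym (subst (W vh ≤_) (+-comm (Z vh) 1) (W≤Z+1 vh vh-in vh≢p))
               (subst (_< W vh) (trans low same) Wvl<Wvh)

    topBound : ∀ {vh} → InRange n vh → vh ≢ p → W vh ≡ suc (Z vh) → suc (Z n) ≤ W n
    topBound {vh} vh-in vh≢p Wvh≡ with m≤n⇒m<n∨m≡n (proj₂ vh-in)
    ... | inj₂ refl = ≤-reflexive (sym Wvh≡)
    ... | inj₁ vh<n = ≤-reflexive (sym (aboveJump (proj₁ vh-in) vh≢p n-inRange (p≢n ∘ sym) vh<n Wvh≡))

    letters : ∀ {vl vh} → InRange n vl → vl ≢ p → InRange n vh → vh ≢ p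
      → W vl ≡ Z vl → W vh ≡ suc (Z vh) → (∀ v → vl < v → v < vh → v ≡ p)
      → ∀ j → 1 ≤ j → j < n → w j ≡ (if vh ≤ᵇ perm π j then suc (z π j) else z π j)
    letters {vl} {vh} vl-in vl≢p vh-in vh≢p low high onlyP j j≥1 j<n =
      trans (cong w (sym (permInv-perm j-in))) (byRank (vh ≤ᵇ v) refl)
      where
      j-in : InRange n j
      j-in = j≥1 , <⇒≤ j<n
      v = perm π j
      v-in = perm-inRange j-in
      v≢p = perm≢p j-in j<n
      byRank : ∀ b → (vh ≤ᵇ v) ≡ b → W v ≡ (if b then suc (Z v) else Z v)
      byRank true vh≤ᵇv with m≤n⇒m<n∨m≡n (≤ᵇ⇒≤ vh v (subst T (sym vh≤ᵇv) tt))
      ... | inj₂ refl = high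
      ... | inj₁ vh<v = aboveJump (proj₁ vh-in) vh≢p v-in v≢p vh<v high
      byRank false vh≰ᵇv with <-cmp v vl
      ... | tri≈ _ refl _ = low
      ... | tri< v<vl _ _ = belowJump v-in v≢p vl≢p v<vl (proj₂ vl-in) low
      ... | tri> _ _ vl<v = ⊥-elim (v≢p (onlyP v vl<v (≰⇒> (λ vh≤v → subst T vh≰ᵇv (≤⇒≤ᵇ vh≤v)))))

    determined : ∀ {lo hi} → InRange n lo → lo < n → InRange n hi → hi < n
      → perm π lo < perm π hi → Z (perm π lo) ≡ Z (perm π hi) → w lo ≢ w hi
      → (∀ v → perm π lo < v → v < perm π hi → v ≡ p)
      → suc (Z n) ≤ W n × (∀ j → 1 ≤ j → j < n → w j ≡ (if perm π hi ≤ᵇ perm π j then suc (z π j) else z π j))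
    determined {lo} {hi} lo-in lo<n hi-in hi<n lt same differ onlyP =
      topBound vh-in vh≢p high , letters vl-in vl≢p vh-in vh≢p low high onlyP
      where
      vl-in = perm-inRange lo-in
      vh-in = perm-inRange hi-in
      vl≢p = perm≢p lo-in lo<n
      vh≢p = perm≢p hi-in hi<n
      atRank : ∀ {x} → InRange n x → w x ≡ W (perm π x)
      atRank x-in = cong w (sym (permInv-perm x-in))
      jumped = jump vl-in vl≢p vh-in vh≢p lt same (λ e → differ (trans (atRank lo-in) (trans e (sym (atRank hi-in)))))
      low = proj₁ jumped
      high = proj₂ jumped

-- What collapsedness yields about the blocks starting at ℓ and r: equal
-- z-values over the common length d = |r − ℓ|, a letter of w where the blocks
-- differ, and consecutive ranks at the ends of the blocks.
record Square {n : ℕ} (π : Permutation′ n) (w : Seq) : Set where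
  field
    d            : ℕ
    d≥1          : 1 ≤ d
    d≡|r-ℓ|      : d ≡ ∣ rIdx π - ℓIdx π ∣
    ℓ+d≤n        : ℓIdx π + d ≤ n
    r+d≤n        : rIdx π + d ≤ n
    sameZ        : ∀ t → t < d → z π (ℓIdx π + t) ≡ z π (rIdx π + t)
    notRepeated  : ¬ (∀ t → t < d → w (ℓIdx π + t) ≡ w (rIdx π + t))
    endsAdjacent : ∀ v → ¬ StrictlyBetween (perm π (ℓIdx π + d)) v (perm π (rIdx π + d))

module CollapsedAnalysis {n : ℕ} (π : Permutation′ n) (w : Seq) (pat : Pat w n π)
  (p≢1 : perm π n ≢ 1) (p≢n : perm π n ≢ n) (sq : Square π w) where
  open PermutationFacts π
  open PatternBounds π w pat p≢1 p≢n
  open Square sq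

  ℓ+t-inRange : ∀ {t} → t ≤ d → InRange n (ℓ + t)
  ℓ+t-inRange t≤d = ≤-trans (proj₁ ℓ-inRange) (m≤m+n ℓ _) , ≤-trans (+-monoʳ-≤ ℓ t≤d) ℓ+d≤n

  r+t-inRange : ∀ {t} → t ≤ d → InRange n (r + t)
  r+t-inRange t≤d = ≤-trans (proj₁ r-inRange) (m≤m+n r _) , ≤-trans (+-monoʳ-≤ r t≤d) r+d≤n

  ℓ+t<n : ∀ {t} → t < d → ℓ + t < n
  ℓ+t<n t<d = <-≤-trans (+-monoʳ-< ℓ t<d) ℓ+d≤n

  r+t<n : ∀ {t} → t < d → r + t < n
  r+t<n t<d = <-≤-trans (+-monoʳ-< r t<d) r+d≤n

  OnlyPBetween : ℕ → Set
  OnlyPBetween t = ∀ v → StrictlyBetween (perm π (ℓ + t)) v (perm π (r + t)) → v ≡ p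

  -- If only p could lie between the ranks at step t + 1, these ranks do not
  -- enclose p: otherwise they would be p ∓ 1, i.e. the positions would be ℓ, r.
  notAroundP : ∀ t → suc t ≤ d → OnlyPBetween (suc t) → ¬ StrictlyBetween (perm π (ℓ + suc t)) p (perm π (r + suc t))
  notAroundP t t<d only (inj₁ (α<p , p<β)) =
    m+1+n≢m ℓ (perm-injective (ℓ+t-inRange t<d) ℓ-inRange
      (trans (proj₁ (onlyBetween⇒adjacent only α<p p<β)) (sym perm-ℓ)))
  notAroundP t t<d only (inj₂ (β<p , p<α)) = <-asym (subst (ℓ <_) ℓ+t+1≡r (m<m+n ℓ (s≤s z≤n)))
                                                    (subst (r <_) r+t+1≡ℓ (m<m+n r (s≤s z≤n)))
    where
    adjacent = onlyBetween⇒adjacent (λ v → only v ∘ StrictlyBetween-sym) β<p p<α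
    r+t+1≡ℓ = perm-injective (r+t-inRange t<d) ℓ-inRange (trans (proj₁ adjacent) (sym perm-ℓ))
    ℓ+t+1≡r = perm-injective (ℓ+t-inRange t<d) r-inRange (trans (proj₂ adjacent) (sym perm-r))

  -- Passing from step t to t + 1 maps a rank v ≠ p between the ranks at
  -- step t to the rank of its successor, which lies between those at t + 1.
  onlyPBetween-step : ∀ t → suc t ≤ d → OnlyPBetween (suc t) → OnlyPBetween t
  onlyPBetween-step t t<d only v between with v ≟ p
  ... | yes v≡p = v≡p
  ... | no v≢p = ⊥-elim (notAroundP t t<d only (subst (λ g → StrictlyBetween _ g _) (only _ (next between)) (next between)))
    where
    t≤d = <⇒≤ t<d
    advance : ∀ q → perm π (suc (q + t)) ≡ perm π (q + suc t)
    advance q = cong (perm π) (sym (+-suc q t))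
    next : StrictlyBetween (perm π (ℓ + t)) v (perm π (r + t))
      → StrictlyBetween (perm π (ℓ + suc t)) (perm π (suc (s v))) (perm π (r + suc t))
    next (inj₁ (α<v , v<β)) =
      let ord = successorBetween (ℓ+t-inRange t≤d) (ℓ+t<n t<d) (r+t-inRange t≤d) (r+t<n t<d) α<v v<β v≢p (sameZ t t<d)
      in inj₂ (subst (_< _) (advance r) (proj₁ ord) , subst (_ <_) (advance ℓ) (proj₂ ord))
    next (inj₂ (β<v , v<α)) =
      let ord = successorBetween (r+t-inRange t≤d) (r+t<n t<d) (ℓ+t-inRange t≤d) (ℓ+t<n t<d) β<v v<α v≢p (sym (sameZ t t<d))
      in inj₁ (subst (_< _) (advance ℓ) (proj₁ ord) , subst (_ <_) (advance r) (proj₂ ord))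

  onlyPBetween : ∀ t → t ≤ d → OnlyPBetween t
  onlyPBetween t t≤d = downFrom (d ∸ t) t (m+[n∸m]≡n t≤d)
    where
    downFrom : ∀ k t → t + k ≡ d → OnlyPBetween t
    downFrom zero t t+0≡d v = ⊥-elim ∘ endsAdjacent v ∘ subst (λ q → StrictlyBetween (perm π (ℓ + q)) v (perm π (r + q))) t≡d
      where t≡d = trans (sym (+-identityʳ t)) t+0≡d
    downFrom (suc k) t t+k+1≡d = onlyPBetween-step t (subst (suc t ≤_) t+k+1≡d (≤-trans (s≤s (m≤m+n t k)) (≤-reflexive (sym (+-suc t k)))))
      (downFrom k (suc t) (trans (sym (+-suc t k)) t+k+1≡d))

  Oriented : ℕ → Set
  Oriented t = (t % 2 ≡ 0 × perm π (ℓ + t) < perm π (r + t)) ⊎ (t % 2 ≡ 1 × perm π (r + t) < perm π (ℓ + t))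

  oriented : ∀ t → t < d → Oriented t
  oriented zero _ = inj₁ (refl , subst₂ _<_ (trans (sym perm-ℓ) (cong (perm π) (sym (+-identityʳ ℓ))))
                                            (trans (sym perm-r) (cong (perm π) (sym (+-identityʳ r))))
                                            (s≤s (m∸n≤m p 1)))
  oriented (suc t) t+1<d with oriented t (<-trans (n<1+n t) t+1<d)
  ... | inj₁ (even , lt) = inj₂ (even⇒suc-odd t even , subst₂ (λ a b → perm π a < perm π b) (sym (+-suc r t)) (sym (+-suc ℓ t))
          (positionReversal (ℓ+t-inRange t≤d) (ℓ+t<n t<d) (r+t-inRange t≤d) (r+t<n t<d) lt (sameZ t t<d)))
    where t<d = <-trans (n<1+n t) t+1<d
          t≤d = <⇒≤ t<d
  ... | inj₂ (odd , lt) = inj₁ (odd⇒suc-even t odd , subst₂ (λ a b → perm π a < perm π b) (sym (+-suc ℓ t)) (sym (+-suc r t))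
          (positionReversal (r+t-inRange t≤d) (r+t<n t<d) (ℓ+t-inRange t≤d) (ℓ+t<n t<d) lt (sym (sameZ t t<d))))
    where t<d = <-trans (n<1+n t) t+1<d
          t≤d = <⇒≤ t<d

  zi-even : ∀ t j → t % 2 ≡ 0 → zi π t j ≡ (if perm π (r + t) ≤ᵇ perm π j then suc (z π j) else z π j)
  zi-even t j e rewrite e | ∧-identityʳ (perm π (r + t) ≤ᵇ perm π j) | ∧-zeroʳ (perm π (ℓ + t) ≤ᵇ perm π j)
    | ∨-identityʳ (perm π (r + t) ≤ᵇ perm π j) = refl

  zi-odd : ∀ t j → t % 2 ≡ 1 → zi π t j ≡ (if perm π (ℓ + t) ≤ᵇ perm π j then suc (z π j) else z π j)
  zi-odd t j e rewrite e | ∧-identityʳ (perm π (ℓ + t) ≤ᵇ perm π j) | ∧-zeroʳ (perm π (r + t) ≤ᵇ perm π j) = refl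

  m-rank : perm π (mIdx π) ≡ n
  m-rank = perm-permInv n-inRange

  zi-top : ∀ i → zi π i (mIdx π) ≡ suc (z π (mIdx π))
  zi-top i with parity i
  ... | inj₁ e = trans (zi-even i (mIdx π) e) (if-true (≤⇒≤ᵇ (subst (perm π (r + i) ≤_) (sym m-rank) (perm≤n (r + i)))))
  ... | inj₂ o = trans (zi-odd i (mIdx π) o) (if-true (≤⇒≤ᵇ (subst (perm π (ℓ + i) ≤_) (sym m-rank) (perm≤n (ℓ + i)))))

  underUpperBound : W n ≤ Z n + 1
    → suc (Z n) ≤ W n × ∃[ t ] (t < d × (∀ j → 1 ≤ j → j < n → w j ≡ zi π t j))
  underUpperBound H with boundedCounterexample (λ t → w (ℓ + t) ≟ w (r + t)) d notRepeated
  ... | t , t<d , differ with oriented t t<d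
  ...   | inj₁ (even , lt) =
          let (top , formula) = determined (ℓ+t-inRange t≤d) (ℓ+t<n t<d) (r+t-inRange t≤d) (r+t<n t<d) lt (sameZ t t<d) differ
                                  (λ v α<v v<β → onlyPBetween t t≤d v (inj₁ (α<v , v<β)))
          in top , t , t<d , λ j j≥1 j<n → trans (formula j j≥1 j<n) (sym (zi-even t j even))
    where open UnderUpperBound H
          t≤d = <⇒≤ t<d
  ...   | inj₂ (odd , lt) =
          let (top , formula) = determined (r+t-inRange t≤d) (r+t<n t<d) (ℓ+t-inRange t≤d) (ℓ+t<n t<d) lt (sym (sameZ t t<d)) (differ ∘ sym)
                                  (λ v β<v v<α → onlyPBetween t t≤d v (inj₂ (β<v , v<α)))
          in top , t , t<d , λ j j≥1 j<n → trans (formula j j≥1 j<n) (sym (zi-odd t j odd))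
    where open UnderUpperBound H
          t≤d = <⇒≤ t<d

  minimalLetter : (suc (z π (mIdx π)) ≤ w (mIdx π))
    × ((w (mIdx π) ≡ suc (z π (mIdx π)))
        ⇔ (∃[ i ] (i < ∣ r - ℓ ∣ × (∀ j → 1 ≤ j → j < n → w j ≡ zi π i j))))
  minimalLetter = subst (_≤ W n) (sym (cong suc z-m)) lowerBound , mk⇔ attained attaining
    where
    z-m : z π (mIdx π) ≡ Z n
    z-m = cong Z m-rank
    m-inRange = permInv-inRange n-inRange
    m<n = s<n n-inRange (p≢n ∘ sym)
    lowerBound : suc (Z n) ≤ W n
    lowerBound with W n ≤? Z n + 1
    ... | yes H = proj₁ (underUpperBound H)
    ... | no H̸ = ≤-trans (≤-reflexive (+-comm 1 (Z n))) (<⇒≤ (≰⇒> H̸))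
    attained : w (mIdx π) ≡ suc (z π (mIdx π)) → ∃[ i ] (i < ∣ r - ℓ ∣ × (∀ j → 1 ≤ j → j < n → w j ≡ zi π i j))
    attained e with proj₂ (underUpperBound (≤-reflexive (trans e (trans (cong suc z-m) (+-comm 1 (Z n))))))
    ... | t , t<d , formula = t , subst (t <_) d≡|r-ℓ| t<d , formula
    attaining : ∃[ i ] (i < ∣ r - ℓ ∣ × (∀ j → 1 ≤ j → j < n → w j ≡ zi π i j)) → w (mIdx π) ≡ suc (z π (mIdx π))
    attaining (i , _ , formula) = trans (formula (mIdx π) (proj₁ m-inRange) m<n) (zi-top i)

-- A collapsed pattern has the square structure: the z-word from ℓ (or r) is
-- the square of the z-word from r (or ℓ); on the repeated block w cannot
-- repeat (noSquareBetween, the suffix at n lying between those at ℓ and r),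
-- and the blocks end at n and at r (or ℓ), whose ranks are p and p ± 1.
squareOf : ∀ {n} (π : Permutation′ n) (w : Seq) → Pat w n π → Collapsed π → Square π w
squareOf {n} π w pat (p≢1 , p≢n , inj₁ ℓ-square)
  with squareValues (z π) n (ℓIdx π) (rIdx π) (<⇒≤ ℓ<n) r<n ℓ-square
  where open PatternBounds π w pat p≢1 p≢n
... | d , d≥1 , ℓ+d≡r , r+d≡n , same = record
  { d = d ; d≥1 = d≥1
  ; d≡|r-ℓ| = trans (sym (m+n∸m≡n ℓ d)) (trans (cong (_∸ ℓ) ℓ+d≡r)
      (sym (trans (∣-∣-comm r ℓ) (m≤n⇒∣m-n∣≡n∸m (subst (ℓ ≤_) ℓ+d≡r (m≤m+n ℓ d))))))
  ; ℓ+d≤n = subst (_≤ n) (sym ℓ+d≡r) (<⇒≤ r<n)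
  ; r+d≤n = ≤-reflexive r+d≡n
  ; sameZ = same
  ; notRepeated = λ repeat → noSquareBetween w ℓ r n d d≥1 ℓ+d≡r r+d≡n repeat (inj₁ ℓ<n<r)
  ; endsAdjacent = nothingBetweenConsecutive
      (inj₁ (trans (cong (perm π) ℓ+d≡r) (trans perm-r (cong (suc ∘ perm π) (sym r+d≡n)))))
  }
  where open PatternBounds π w pat p≢1 p≢n
squareOf {n} π w pat (p≢1 , p≢n , inj₂ r-square)
  with squareValues (z π) n (rIdx π) (ℓIdx π) (<⇒≤ r<n) ℓ<n r-square
  where open PatternBounds π w pat p≢1 p≢n
... | d , d≥1 , r+d≡ℓ , ℓ+d≡n , same = record
  { d = d ; d≥1 = d≥1
  ; d≡|r-ℓ| = trans (sym (m+n∸m≡n r d)) (trans (cong (_∸ r) r+d≡ℓ)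
      (sym (m≤n⇒∣m-n∣≡n∸m (subst (r ≤_) r+d≡ℓ (m≤m+n r d)))))
  ; ℓ+d≤n = ≤-reflexive ℓ+d≡n
  ; r+d≤n = subst (_≤ n) (sym r+d≡ℓ) (<⇒≤ ℓ<n)
  ; sameZ = λ t t<d → sym (same t t<d)
  ; notRepeated = λ repeat → noSquareBetween w r ℓ n d d≥1 r+d≡ℓ ℓ+d≡n (λ t t<d → sym (repeat t t<d)) (inj₂ ℓ<n<r)
  ; endsAdjacent = nothingBetweenConsecutive
      (inj₁ (trans (cong (perm π) ℓ+d≡n)
        (trans (sym (trans (sym (+1≡suc (p ∸ 1))) p-1+1≡p)) (cong suc (trans (sym perm-ℓ) (cong (perm π) (sym r+d≡ℓ)))))))
  }
  where open PatternBounds π w pat p≢1 p≢n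

lemma3 : (n : ℕ) (π : Permutation′ n) (w : ℕ → ℕ) →
  Collapsed π → Pat w n π →
  (suc (z π (mIdx π)) ≤ w (mIdx π))
    × ((w (mIdx π) ≡ suc (z π (mIdx π)))
        ⇔ (∃[ i ] (i < ∣ rIdx π - ℓIdx π ∣
              × (∀ j → 1 ≤ j → j < n → w j ≡ zi π i j))))
lemma3 n π w collapsed@(p≢1 , p≢n , _) pat =
  CollapsedAnalysis.minimalLetter π w pat p≢1 p≢n (squareOf π w pat collapsed)
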